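{- The set of limiting densities of minor-closed families of simple graphs contains the set of densities of density-minimal graphs.
   Context: All graphs are finite simple graphs. A minor of $G$ is a simple graph (with at least one vertex) obtained from $G$ by a sequence of edge contractions (merging resulting parallel edges and deleting resulting loops), edge deletions and vertex deletions; a proper minor is one obtained by at least one operation. A family is minor-closed if it contains all minors of its members. The density of a graph with $m$ edges and $n$ vertices is $m/n$; $G$ is density-minimal if no proper minor of $G$ has density greater than or equal to that of $G$. The limiting density of a minor-closed family $\mathcal{F}$ is $\limsup_{n\to\infty}\mathrm{ex}_{\mathcal{F}}(n)/n$, where $\mathrm{ex}_{\mathcal{F}}(n)$ is the maximum number of edges of an $n$-vertex graph in $\mathcal{F}$ ($0$ if none). -}

module Defs where

open import Data.Bool using (Bool; true; false; _∧_; _∨_; not; if_then_else_)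
open import Data.Nat as ℕ using (ℕ; zero; suc; _≤_; _<ᵇ_)
open import Data.Fin using (Fin; toℕ; punchIn; _≟_)
open import Data.List using (List; map; allFin)
open import Data.Nat.ListAction using (sum)
open import Data.Integer using (+_)
open import Data.Rational as ℚ using (ℚ; 0ℚ)
open import Data.Product using (Σ; ∃; ∃-syntax; _×_)
open import Data.Sum using (_⊎_)
open import Function.Bundles using (_↔_; Inverse)
open import Relation.Nullary.Decidable using (⌊_⌋)
open import Relation.Binary.PropositionalEquality using (_≡_)
open import Relation.Binary.Construct.Closure.ReflexiveTransitive using (Star)

-- The raw Boolean matrix 'adj' is only read through the symmetrised,
-- loop-free adjacency 'E' below, so every matrix denotes a simple graph.
record Graph : Set where
  constructor graph
  field
    k   : ℕ
    adj : Fin (suc k) → Fin (suc k) → Bool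
open Graph public

∣V∣ : Graph → ℕ
∣V∣ G = suc (k G)

_==_ : ∀ {n} → Fin n → Fin n → Bool
i == j = ⌊ i ≟ j ⌋

E : (G : Graph) → Fin (suc (k G)) → Fin (suc (k G)) → Bool
E G i j = not (i == j) ∧ (adj G i j ∨ adj G j i)

∣E∣ : Graph → ℕ
∣E∣ G = sum (map (λ i → sum (map (λ j →
          if E G i j ∧ (toℕ i <ᵇ toℕ j) then 1 else 0)
          (allFin (suc (k G))))) (allFin (suc (k G))))

density : Graph → ℚ
density G = (+ ∣E∣ G) ℚ./ ∣V∣ G

_≅_ : Graph → Graph → Set
H ≅ G = Σ (Fin (suc (k H)) ↔ Fin (suc (k G))) λ σ →
          ∀ i j → E G (Inverse.to σ i) (Inverse.to σ j) ≡ E H i j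

deleteEdge : (G : Graph) → Fin (suc (k G)) → Fin (suc (k G)) → Graph
deleteEdge G u v = graph (k G) λ a b →
  E G a b ∧ not ((a == u ∧ b == v) ∨ (a == v ∧ b == u))

deleteVertex : ∀ {k} → (Fin (suc (suc k)) → Fin (suc (suc k)) → Bool) →
               Fin (suc (suc k)) → Graph
deleteVertex {k} a v = graph k λ x y →
  E (graph (suc k) a) (punchIn v x) (punchIn v y)

-- contract edge uv: v is merged into u (and removed)
contract : ∀ {k} → (Fin (suc (suc k)) → Fin (suc (suc k)) → Bool) →
           Fin (suc (suc k)) → Fin (suc (suc k)) → Graph
contract {k} a u v = graph k λ x y →
  let G = graph (suc k) a ; x' = punchIn v x ; y' = punchIn v y in
  E G x' y' ∨ (x' == u ∧ E G v y') ∨ (y' == u ∧ E G x' v)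

data Op : Graph → Graph → Set where
  delE : (G : Graph) (u v : Fin (suc (k G))) → E G u v ≡ true →
         Op (deleteEdge G u v) G
  delV : ∀ {k} (a : Fin (suc (suc k)) → Fin (suc (suc k)) → Bool)
         (v : Fin (suc (suc k))) → Op (deleteVertex a v) (graph (suc k) a)
  contr : ∀ {k} (a : Fin (suc (suc k)) → Fin (suc (suc k)) → Bool)
          (u v : Fin (suc (suc k))) → E (graph (suc k) a) u v ≡ true →
          Op (contract a u v) (graph (suc k) a)

-- one step: an operation, or relabelling (graphs are taken up to isomorphism)
Step : Graph → Graph → Set
Step H G = H ≅ G ⊎ Op H G

_≼_ : Graph → Graph → Set
H ≼ G = Star Step H G

_≺_ : Graph → Graph → Set
H ≺ G = ∃[ G₁ ] ∃[ G₂ ] (H ≼ G₁ × Op G₁ G₂ × G₂ ≼ G)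

DensityMinimal : Graph → Set
DensityMinimal G = ∀ H → H ≺ G → density H ℚ.< density G

Family : Set₁
Family = Graph → Set

MinorClosed : Family → Set
MinorClosed F = ∀ G H → F G → H ≼ G → F H

-- "ex_F(n)/n > r", with ex_F(n) = 0 when F has no n-vertex graph
-- (ex_F(n)/n is the maximum of density over n-vertex members)
ExAbove : Family → ℕ → ℚ → Set
ExAbove F n r = (∃[ G ] (F G × ∣V∣ G ≡ n × r ℚ.< density G)) ⊎ (r ℚ.< 0ℚ)

-- limsup_{n→∞} ex_F(n)/n = q  (q finite), unfolded:
-- for every ε > 0, eventually ex_F(n)/n < q + ε, and
-- infinitely often ex_F(n)/n > q - ε.
LimitingDensity : Family → ℚ → Set
LimitingDensity F q =
  (∀ ε → 0ℚ ℚ.< ε → ∃[ N ] ∀ G → F G → N ℕ.≤ ∣V∣ G → density G ℚ.< q ℚ.+ ε)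
  × (∀ ε → 0ℚ ℚ.< ε → ∀ N → ∃[ n ] (N ℕ.≤ n × ExAbove F n (q ℚ.- ε)))

module Submission where

-- Let F be the family of graphs all of whose minors are at most as dense as G. It is
-- minor-closed by construction and all its members have density at most d = density G.
-- G lies in F: a proper minor is sparser by minimality, and a minor reached by relabelling
-- alone has the same counts. F is closed under disjoint union, because a minor of A ⊔ B
-- still carries a 2-colouring crossed by no edge whose colour classes induce minors of A
-- and of B (or are empty), and the edge and vertex counts of the classes add up. So the
-- disjoint unions of copies of G lie in F, have density d and arbitrarily many vertices,
-- and the limiting density of F is d.

open import Defs
open import Data.Bool using (Bool; true; false; _∧_; _∨_; not; if_then_else_; T)
import Data.Bool.Properties as 𝔹
open import Data.Empty using (⊥; ⊥-elim)
open import Data.Fin as Fin using (Fin; toℕ; punchIn; punchOut; _↑ˡ_; _↑ʳ_; splitAt)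
import Data.Fin.Properties as FinP
open import Data.Fin.Permutation using (Permutation; _⟨$⟩ʳ_; permutation; ↔⇒≡)
open import Data.List using (map; allFin; tabulate)
import Data.List.Properties as ListP
import Data.Nat.ListAction as List
open import Data.Nat as ℕ using (ℕ; zero; suc; _+_; _*_; _<ᵇ_)
import Data.Nat.Properties as ℕP
open import Data.Nat.Solver using (module +-*-Solver)
open import Data.Product using (∃-syntax; _×_; _,_; proj₁; proj₂)
open import Data.Sum using (_⊎_; inj₁; inj₂; [_,_]′)
open import Data.Unit using (⊤; tt)
import Data.Integer as ℤ
import Data.Integer.Properties as ℤP
open import Data.Rational as ℚ using (0ℚ)
import Data.Rational.Properties as ℚP
open import Data.Rational.Unnormalised using (mkℚᵘ; *≤*)
import Data.Rational.Unnormalised.Properties as ℚᵘP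
open import Function using (_∘_; id)
open import Function.Bundles using (Inverse; _⇔_; mk⇔; Equivalence)
open import Function.Construct.Identity using (↔-id)
open import Relation.Nullary using (¬_; yes; no)
open import Relation.Binary using (tri<; tri≈; tri>)
open import Relation.Binary.PropositionalEquality
open import Relation.Binary.Construct.Closure.ReflexiveTransitive using (ε; _◅_; _◅◅_)
open import Algebra.Properties.CommutativeMonoid.Sum ℕP.+-0-commutativeMonoid
  using (sum; sum-cong-≗; ∑-distrib-+; ∑-comm; ∑-permute; sum-replicate-zero)

open +-*-Solver using (solve; _:*_; _:=_; con)

Vertex : Graph → Set
Vertex X = Fin (suc (k X))

IsInjective : ∀ {A B : Set} → (A → B) → Set
IsInjective f = ∀ a b → f a ≡ f b → a ≡ b

==-refl : ∀ {n} (i : Fin n) → (i == i) ≡ true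
==-refl i with i Fin.≟ i
... | yes _ = refl
... | no i≢i = ⊥-elim (i≢i refl)

≢⇒==-false : ∀ {n} {i j : Fin n} → i ≢ j → (i == j) ≡ false
≢⇒==-false {i = i} {j} i≢j with i Fin.≟ j
... | yes i≡j = ⊥-elim (i≢j i≡j)
... | no _ = refl

==-true⇒≡ : ∀ {n} {i j : Fin n} → (i == j) ≡ true → i ≡ j
==-true⇒≡ {i = i} {j} h with i Fin.≟ j
... | yes i≡j = i≡j

==-sym : ∀ {n} (i j : Fin n) → (i == j) ≡ (j == i)
==-sym i j with i Fin.≟ j
... | yes refl = sym (==-refl i)
... | no i≢j = sym (≢⇒==-false (i≢j ∘ sym))

injective⇒==-preserved : ∀ {m n} (f : Fin m → Fin n) → IsInjective f →
                         ∀ a b → (f a == f b) ≡ (a == b)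
injective⇒==-preserved f f-inj a b with a Fin.≟ b
... | yes refl = ==-refl (f a)
... | no a≢b = ≢⇒==-false (a≢b ∘ f-inj a b)

∧-true : ∀ {a b} → a ∧ b ≡ true → a ≡ true × b ≡ true
∧-true {true} {true} _ = refl , refl

∨-true : ∀ {a b} → a ∨ b ≡ true → a ≡ true ⊎ b ≡ true
∨-true {true} _ = inj₁ refl
∨-true {false} h = inj₂ h

not∧-absorb : ∀ b d → (d ≡ true → b ≡ false) → not b ∧ d ≡ d
not∧-absorb b false _ = 𝔹.∧-zeroʳ (not b)
not∧-absorb b true d⇒¬b rewrite d⇒¬b refl = refl

-- The edge relation and induced subgraphs

E-sym : ∀ X (i j : Vertex X) → E X i j ≡ E X j i
E-sym X i j rewrite ==-sym i j | 𝔹.∨-comm (adj X i j) (adj X j i) = refl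

E-irrefl : ∀ X (i : Vertex X) → E X i i ≡ false
E-irrefl X i rewrite ==-refl i = refl

E⇒≢ : ∀ X {i j : Vertex X} → E X i j ≡ true → i ≢ j
E⇒≢ X {i} h refl with () ← trans (sym (E-irrefl X i)) h

E⇒==-false : ∀ X {i j : Vertex X} → E X i j ≡ true → (i == j) ≡ false
E⇒==-false X = ≢⇒==-false ∘ E⇒≢ X

induced : (X : Graph) {m : ℕ} → (Fin (suc m) → Vertex X) → Graph
induced X {m} f = graph m (λ a b → E X (f a) (f b))

E-induced : ∀ X {m} (f : Fin (suc m) → Vertex X) → IsInjective f →
            ∀ a b → E (induced X f) a b ≡ E X (f a) (f b)
E-induced X f f-inj a b with a Fin.≟ b
... | yes refl rewrite E-irrefl X (f a) = refl
... | no _ rewrite E-sym X (f b) (f a) = 𝔹.∨-idem (E X (f a) (f b))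

same-E⇒≅ : ∀ {m} {a b : Fin (suc m) → Fin (suc m) → Bool} →
           (∀ i j → E (graph m b) i j ≡ E (graph m a) i j) → graph m a ≅ graph m b
same-E⇒≅ {m} same = ↔-id (Fin (suc m)) , same

same-adj⇒≅ : ∀ {m} {a b : Fin (suc m) → Fin (suc m) → Bool} →
             (∀ i j → a i j ≡ b i j) → graph m a ≅ graph m b
same-adj⇒≅ {a = a} {b} same = same-E⇒≅ {a = a} {b} λ i j →
  sym (cong₂ (λ x y → not (i == j) ∧ (x ∨ y)) (same i j) (same j i))

sameEdge : ∀ {n} (u v x y : Fin n) → Bool
sameEdge u v x y = (x == u ∧ y == v) ∨ (x == v ∧ y == u)

sameEdge-sym : ∀ {n} (u v x y : Fin n) → sameEdge u v y x ≡ sameEdge u v x y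
sameEdge-sym u v x y rewrite 𝔹.∧-comm (y == u) (x == v) | 𝔹.∧-comm (y == v) (x == u) =
  𝔹.∨-comm (x == v ∧ y == u) (x == u ∧ y == v)

E-deleteEdge : ∀ X (u v x y : Vertex X) →
               E (deleteEdge X u v) x y ≡ E X x y ∧ not (sameEdge u v x y)
E-deleteEdge X u v x y = begin
  not (x == y) ∧ (D x y ∨ D y x)  ≡⟨ cong (λ t → not (x == y) ∧ (D x y ∨ t)) D-sym ⟩
  not (x == y) ∧ (D x y ∨ D x y)  ≡⟨ cong (not (x == y) ∧_) (𝔹.∨-idem (D x y)) ⟩
  not (x == y) ∧ D x y            ≡⟨ not∧-absorb (x == y) (D x y) (E⇒==-false X ∘ proj₁ ∘ ∧-true) ⟩
  D x y                           ∎
  where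
  open ≡-Reasoning
  D : Vertex X → Vertex X → Bool
  D x y = E X x y ∧ not (sameEdge u v x y)
  D-sym : D y x ≡ D x y
  D-sym = cong₂ _∧_ (E-sym X y x) (cong not (sameEdge-sym u v x y))

contractAdj : ∀ {k} (a : Fin (suc (suc k)) → Fin (suc (suc k)) → Bool)
              (u v : Fin (suc (suc k))) (x y : Fin (suc k)) → Bool
contractAdj {k} a u v x y = E Z x' y' ∨ (x' == u ∧ E Z v y') ∨ (y' == u ∧ E Z x' v)
  where Z = graph (suc k) a ; x' = punchIn v x ; y' = punchIn v y

E-contract : ∀ {k} (a : Fin (suc (suc k)) → Fin (suc (suc k)) → Bool) (u v : Fin (suc (suc k)))
             (x y : Fin (suc k)) → E (contract a u v) x y ≡ not (x == y) ∧ contractAdj a u v x y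
E-contract {k} a u v x y = cong (not (x == y) ∧_) (begin
  R x y ∨ R y x  ≡⟨ cong (R x y ∨_) R-sym ⟩
  R x y ∨ R x y  ≡⟨ 𝔹.∨-idem (R x y) ⟩
  R x y          ∎)
  where
  open ≡-Reasoning
  Z = graph (suc k) a
  x' = punchIn v x
  y' = punchIn v y
  R = contractAdj a u v
  R-sym : R y x ≡ R x y
  R-sym = cong₂ _∨_ (E-sym Z y' x')
    (trans (cong₂ _∨_ (cong (y' == u ∧_) (E-sym Z v x')) (cong (x' == u ∧_) (E-sym Z y' v)))
           (𝔹.∨-comm (y' == u ∧ E Z x' v) (x' == u ∧ E Z v y')))

-- Edge counts and densities

𝟙 : Bool → ℕ
𝟙 b = if b then 1 else 0

degreeSum : Graph → ℕ
degreeSum X = sum λ i → sum λ j → 𝟙 (E X i j)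

forwardEdge : ∀ X → Vertex X → Vertex X → ℕ
forwardEdge X i j = 𝟙 (E X i j ∧ (toℕ i <ᵇ toℕ j))

sum-map-allFin : ∀ {n} (f : Fin n → ℕ) → List.sum (map f (allFin n)) ≡ sum f
sum-map-allFin {n} f = trans (cong List.sum (ListP.map-tabulate id f)) (sum-tabulate f)
  where
  sum-tabulate : ∀ {n} (f : Fin n → ℕ) → List.sum (tabulate f) ≡ sum f
  sum-tabulate {zero} f = refl
  sum-tabulate {suc n} f = cong (f Fin.zero +_) (sum-tabulate (f ∘ Fin.suc))

∣E∣≡∑∑forwardEdge : ∀ X → ∣E∣ X ≡ sum λ i → sum λ j → forwardEdge X i j
∣E∣≡∑∑forwardEdge X = trans
  (cong List.sum (ListP.map-cong (λ i → sum-map-allFin (forwardEdge X i)) (allFin _)))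
  (sum-map-allFin λ i → sum (forwardEdge X i))

<ᵇ-true : ∀ {m n} → m ℕ.< n → (m <ᵇ n) ≡ true
<ᵇ-true {m} {n} m<n with m <ᵇ n | ℕP.<⇒<ᵇ m<n
... | true | _ = refl

<ᵇ-false : ∀ {m n} → ¬ m ℕ.< n → (m <ᵇ n) ≡ false
<ᵇ-false {m} {n} m≮n with m <ᵇ n in eq
... | false = refl
... | true = ⊥-elim (m≮n (ℕP.<ᵇ⇒< m n (subst T (sym eq) _)))

𝟙E≡forwardEdge+backwardEdge : ∀ X i j → 𝟙 (E X i j) ≡ forwardEdge X i j + forwardEdge X j i
𝟙E≡forwardEdge+backwardEdge X i j with ℕP.<-cmp (toℕ i) (toℕ j)
... | tri< i<j _ i≯j
  rewrite <ᵇ-true i<j | <ᵇ-false i≯j | 𝔹.∧-identityʳ (E X i j) | 𝔹.∧-zeroʳ (E X j i)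
  = sym (ℕP.+-identityʳ _)
... | tri≈ _ i≡j _ rewrite FinP.toℕ-injective i≡j | E-irrefl X j = refl
... | tri> i≮j _ i>j
  rewrite <ᵇ-true i>j | <ᵇ-false i≮j | 𝔹.∧-identityʳ (E X j i) | 𝔹.∧-zeroʳ (E X i j) | E-sym X j i
  = refl

handshake : ∀ X → degreeSum X ≡ 2 * ∣E∣ X
handshake X = begin
  sum (λ i → sum λ j → 𝟙 (E X i j))
    ≡⟨ sum-cong-≗ (λ i → sum-cong-≗ (𝟙E≡forwardEdge+backwardEdge X i)) ⟩
  sum (λ i → sum λ j → forwardEdge X i j + forwardEdge X j i)
    ≡⟨ sum-cong-≗ (λ i → ∑-distrib-+ (forwardEdge X i) (λ j → forwardEdge X j i)) ⟩
  sum (λ i → sum (forwardEdge X i) + sum λ j → forwardEdge X j i)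
    ≡⟨ ∑-distrib-+ (sum ∘ forwardEdge X) (λ i → sum λ j → forwardEdge X j i) ⟩
  sum (sum ∘ forwardEdge X) + sum (λ i → sum λ j → forwardEdge X j i)
    ≡⟨ cong (sum (sum ∘ forwardEdge X) +_) (∑-comm λ i j → forwardEdge X j i) ⟩
  sum (sum ∘ forwardEdge X) + sum (sum ∘ forwardEdge X)
    ≡⟨ cong (λ e → e + e) (sym (∣E∣≡∑∑forwardEdge X)) ⟩
  ∣E∣ X + ∣E∣ X
    ≡⟨ cong (∣E∣ X +_) (sym (ℕP.+-identityʳ (∣E∣ X))) ⟩
  2 * ∣E∣ X ∎
  where open ≡-Reasoning

∑∑-permute : ∀ {m n} (f : Fin n → Fin n → ℕ) (π : Permutation m n) →
             (sum λ i → sum λ j → f i j) ≡ (sum λ p → sum λ q → f (π ⟨$⟩ʳ p) (π ⟨$⟩ʳ q))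
∑∑-permute f π = trans (∑-permute (λ i → sum (f i)) π)
                       (sum-cong-≗ (λ p → ∑-permute (f (π ⟨$⟩ʳ p)) π))

∑-↑ : ∀ m n (f : Fin (m + n) → ℕ) → sum f ≡ sum (λ a → f (a ↑ˡ n)) + sum (λ b → f (m ↑ʳ b))
∑-↑ zero n f = refl
∑-↑ (suc m) n f = trans (cong (f Fin.zero +_) (∑-↑ m n (f ∘ Fin.suc)))
                        (sym (ℕP.+-assoc (f Fin.zero) _ _))

degreeSum-≅ : ∀ {X Z} → X ≅ Z → degreeSum X ≡ degreeSum Z
degreeSum-≅ {X} {Z} (σ , E-σ) = sym (trans (∑∑-permute (λ i j → 𝟙 (E Z i j)) σ)
  (sum-cong-≗ (λ p → sum-cong-≗ (λ q → cong 𝟙 (E-σ p q)))))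

∣V∣-≅ : ∀ {X Z} → X ≅ Z → ∣V∣ X ≡ ∣V∣ Z
∣V∣-≅ (σ , _) = ↔⇒≡ σ

≼⇒≺⊎sameCounts : ∀ {X Y} → X ≼ Y → X ≺ Y ⊎ (degreeSum X ≡ degreeSum Y × ∣V∣ X ≡ ∣V∣ Y)
≼⇒≺⊎sameCounts ε = inj₂ (refl , refl)
≼⇒≺⊎sameCounts {X} (inj₂ op ◅ X₁≼Y) = inj₁ (X , _ , ε , op , X₁≼Y)
≼⇒≺⊎sameCounts {X} (_◅_ {j = X₁} (inj₁ X≅X₁) X₁≼Y) with ≼⇒≺⊎sameCounts X₁≼Y
... | inj₁ (G₁ , G₂ , X₁≼G₁ , op , G₂≼Y) = inj₁ (G₁ , G₂ , inj₁ X≅X₁ ◅ X₁≼G₁ , op , G₂≼Y)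
... | inj₂ (d≡ , n≡) = inj₂ (trans (degreeSum-≅ {X} {X₁} X≅X₁) d≡ , trans (∣V∣-≅ {X} {X₁} X≅X₁) n≡)

-- ℚ._/_ is fromℚᵘ ∘ mkℚᵘ, so the comparison reduces to that of unnormalised fractions.
/-≤⇔ : ∀ a b c d → ((ℤ.+ a) ℚ./ suc b ℚ.≤ (ℤ.+ c) ℚ./ suc d) ⇔ (a * suc d ℕ.≤ c * suc b)
/-≤⇔ a b c d = mk⇔ to from
  where
  p≃ = ℚP.toℚᵘ-fromℚᵘ (mkℚᵘ (ℤ.+ a) b)
  q≃ = ℚP.toℚᵘ-fromℚᵘ (mkℚᵘ (ℤ.+ c) d)
  to : (ℤ.+ a) ℚ./ suc b ℚ.≤ (ℤ.+ c) ℚ./ suc d → a * suc d ℕ.≤ c * suc b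
  to h with ℚᵘP.≤-respˡ-≃ p≃ (ℚᵘP.≤-respʳ-≃ q≃ (ℚP.toℚᵘ-mono-≤ h))
  ... | *≤* ad≤cb = ℤP.drop‿+≤+
    (subst₂ ℤ._≤_ (sym (ℤP.pos-* a (suc d))) (sym (ℤP.pos-* c (suc b))) ad≤cb)
  from : a * suc d ℕ.≤ c * suc b → (ℤ.+ a) ℚ./ suc b ℚ.≤ (ℤ.+ c) ℚ./ suc d
  from h = ℚP.toℚᵘ-cancel-≤ (ℚᵘP.≤-respˡ-≃ (ℚᵘP.≃-sym p≃) (ℚᵘP.≤-respʳ-≃ (ℚᵘP.≃-sym q≃)
    (*≤* (subst₂ ℤ._≤_ (ℤP.pos-* a (suc d)) (ℤP.pos-* c (suc b)) (ℤ.+≤+ h)))))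

density-≤⇔ : ∀ X Y →
  density X ℚ.≤ density Y ⇔ ∣V∣ Y * degreeSum X ℕ.≤ degreeSum Y * ∣V∣ X
density-≤⇔ X Y = mk⇔
  (λ h → subst₂ ℕ._≤_ (sym lhs) (sym rhs) (ℕP.*-monoʳ-≤ 2 (Equivalence.to cross h)))
  (λ h → Equivalence.from cross (ℕP.*-cancelˡ-≤ 2 (subst₂ ℕ._≤_ lhs rhs h)))
  where
  cross = /-≤⇔ (∣E∣ X) (k X) (∣E∣ Y) (k Y)
  lhs : ∣V∣ Y * degreeSum X ≡ 2 * (∣E∣ X * ∣V∣ Y)
  lhs = trans (cong (∣V∣ Y *_) (handshake X))
    (solve 2 (λ n e → n :* (con 2 :* e) := con 2 :* (e :* n)) refl (∣V∣ Y) (∣E∣ X))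
  rhs : degreeSum Y * ∣V∣ X ≡ 2 * (∣E∣ Y * ∣V∣ X)
  rhs = trans (cong (_* ∣V∣ X) (handshake Y))
    (solve 2 (λ e n → (con 2 :* e) :* n := con 2 :* (e :* n)) refl (∣E∣ Y) (∣V∣ X))

-- Disjoint union

⊔-adj : ∀ A B → Vertex A ⊎ Vertex B → Vertex A ⊎ Vertex B → Bool
⊔-adj A B (inj₁ i) (inj₁ j) = E A i j
⊔-adj A B (inj₂ i) (inj₂ j) = E B i j
⊔-adj A B (inj₁ _) (inj₂ _) = false
⊔-adj A B (inj₂ _) (inj₁ _) = false

_⊔_ : Graph → Graph → Graph
A ⊔ B = graph (k A + suc (k B)) λ x y → ⊔-adj A B (splitAt (suc (k A)) x) (splitAt (suc (k A)) y)

E-⊔ˡ : ∀ A B (i j : Vertex A) → E (A ⊔ B) (i ↑ˡ suc (k B)) (j ↑ˡ suc (k B)) ≡ E A i j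
E-⊔ˡ A B i j
  rewrite FinP.splitAt-↑ˡ (suc (k A)) i (suc (k B)) | FinP.splitAt-↑ˡ (suc (k A)) j (suc (k B))
        | injective⇒==-preserved (_↑ˡ suc (k B)) (FinP.↑ˡ-injective (suc (k B))) i j
        | E-sym A j i | 𝔹.∨-idem (E A i j)
  = not∧-absorb (i == j) (E A i j) (E⇒==-false A)

E-⊔ʳ : ∀ A B (i j : Vertex B) → E (A ⊔ B) (suc (k A) ↑ʳ i) (suc (k A) ↑ʳ j) ≡ E B i j
E-⊔ʳ A B i j
  rewrite FinP.splitAt-↑ʳ (suc (k A)) (suc (k B)) i | FinP.splitAt-↑ʳ (suc (k A)) (suc (k B)) j
        | injective⇒==-preserved (suc (k A) ↑ʳ_) (FinP.↑ʳ-injective (suc (k A))) i j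
        | E-sym B j i | 𝔹.∨-idem (E B i j)
  = not∧-absorb (i == j) (E B i j) (E⇒==-false B)

-- Two-sided splittings of a graph

module Partitions (P : Graph → Set) (P-≼ : ∀ {A B} → A ≼ B → P B → P A) where

  -- Graphs have at least one vertex, so an empty colour class carries no condition.
  P-on : (X : Graph) (M : ℕ) → (Fin M → Vertex X) → Set
  P-on X zero e = ⊤
  P-on X (suc m) e = P (induced X e)

  record Side (X : Graph) (c : Vertex X → Bool) (s : Bool) : Set where
    constructor side
    field
      M : ℕ
      e : Fin M → Vertex X
      e-injective : IsInjective e
      e-colour : ∀ a → c (e a) ≡ s
      e⁻¹ : ∀ i → c i ≡ s → Fin M
      e∘e⁻¹ : ∀ i p → e (e⁻¹ i p) ≡ i
      P-side : P-on X M e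

  record Split (X : Graph) : Set where
    constructor split
    field
      c : Vertex X → Bool
      c-respects-E : ∀ i j → E X i j ≡ true → c i ≡ c j
      side₁ : Side X c true
      side₂ : Side X c false

  degreeSumOn : ∀ X {M} → (Fin M → Vertex X) → ℕ
  degreeSumOn X e = sum λ a → sum λ b → 𝟙 (E X (e a) (e b))

  module _ {X : Graph} (sp : Split X) where
    open Split sp
    open Side side₁ using () renaming
      (M to M₁; e to e₁; e-injective to e₁-injective; e-colour to e₁-colour; e⁻¹ to e₁⁻¹; e∘e⁻¹ to e₁∘e₁⁻¹)
    open Side side₂ using () renaming
      (M to M₂; e to e₂; e-injective to e₂-injective; e-colour to e₂-colour; e⁻¹ to e₂⁻¹; e∘e⁻¹ to e₂∘e₂⁻¹)

    private
      join : Fin (M₁ + M₂) → Vertex X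
      join p = [ e₁ , e₂ ]′ (splitAt M₁ p)

      join-↑ˡ : ∀ a → join (a ↑ˡ M₂) ≡ e₁ a
      join-↑ˡ a rewrite FinP.splitAt-↑ˡ M₁ a M₂ = refl

      join-↑ʳ : ∀ b → join (M₁ ↑ʳ b) ≡ e₂ b
      join-↑ʳ b rewrite FinP.splitAt-↑ʳ M₁ M₂ b = refl

      index : ∀ i s → c i ≡ s → Fin (M₁ + M₂)
      index i true p = e₁⁻¹ i p ↑ˡ M₂
      index i false p = M₁ ↑ʳ e₂⁻¹ i p

      join∘index : ∀ i s (p : c i ≡ s) → join (index i s p) ≡ i
      join∘index i true p = trans (join-↑ˡ _) (e₁∘e₁⁻¹ i p)
      join∘index i false p = trans (join-↑ʳ _) (e₂∘e₂⁻¹ i p)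

      index∘e₁ : ∀ a s (p : c (e₁ a) ≡ s) → index (e₁ a) s p ≡ a ↑ˡ M₂
      index∘e₁ a true p = cong (_↑ˡ M₂) (e₁-injective _ _ (e₁∘e₁⁻¹ (e₁ a) p))
      index∘e₁ a false p with () ← trans (sym (e₁-colour a)) p

      index∘e₂ : ∀ b s (p : c (e₂ b) ≡ s) → index (e₂ b) s p ≡ M₁ ↑ʳ b
      index∘e₂ b false p = cong (M₁ ↑ʳ_) (e₂-injective _ _ (e₂∘e₂⁻¹ (e₂ b) p))
      index∘e₂ b true p with () ← trans (sym p) (e₂-colour b)

      index∘join : ∀ p → index (join p) (c (join p)) refl ≡ p
      index∘join p with splitAt M₁ p in eq
      ... | inj₁ a = trans (index∘e₁ a (c (e₁ a)) refl) (FinP.splitAt⁻¹-↑ˡ eq)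
      ... | inj₂ b = trans (index∘e₂ b (c (e₂ b)) refl) (FinP.splitAt⁻¹-↑ʳ eq)

      joinπ : Permutation (M₁ + M₂) (suc (k X))
      joinπ = permutation join (λ i → index i (c i) refl) (λ i → join∘index i (c i) refl) index∘join

      ¬E-across : ∀ a b → E X (e₁ a) (e₂ b) ≡ false
      ¬E-across a b with E X (e₁ a) (e₂ b) in eq
      ... | false = refl
      ... | true with () ← trans (sym (e₁-colour a)) (trans (c-respects-E _ _ eq) (e₂-colour b))

      to₁ to₂ row : Vertex X → ℕ
      to₁ i = sum λ a → 𝟙 (E X i (e₁ a))
      to₂ i = sum λ b → 𝟙 (E X i (e₂ b))
      row i = sum λ p → 𝟙 (E X i (join p))

      row-split : ∀ i → row i ≡ to₁ i + to₂ i
      row-split i = trans (∑-↑ M₁ M₂ _) (cong₂ _+_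
        (sum-cong-≗ λ a → cong (𝟙 ∘ E X i) (join-↑ˡ a))
        (sum-cong-≗ λ b → cong (𝟙 ∘ E X i) (join-↑ʳ b)))

      to₂∘e₁≡0 : ∀ a → to₂ (e₁ a) ≡ 0
      to₂∘e₁≡0 a = trans (sum-cong-≗ λ b → cong 𝟙 (¬E-across a b)) (sum-replicate-zero M₂)

      to₁∘e₂≡0 : ∀ b → to₁ (e₂ b) ≡ 0
      to₁∘e₂≡0 b = trans (sum-cong-≗ λ a → cong 𝟙 (trans (E-sym X (e₂ b) (e₁ a)) (¬E-across a b)))
                         (sum-replicate-zero M₁)

    ∣V∣-Split : ∣V∣ X ≡ M₁ + M₂
    ∣V∣-Split = sym (↔⇒≡ joinπ)

    degreeSum-Split : degreeSum X ≡ degreeSumOn X e₁ + degreeSumOn X e₂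
    degreeSum-Split = begin
      degreeSum X
        ≡⟨ ∑∑-permute (λ i j → 𝟙 (E X i j)) joinπ ⟩
      (sum λ p → row (join p))
        ≡⟨ trans (∑-↑ M₁ M₂ _) (cong₂ _+_ (sum-cong-≗ λ a → cong row (join-↑ˡ a))
                                           (sum-cong-≗ λ b → cong row (join-↑ʳ b))) ⟩
      (sum λ a → row (e₁ a)) + (sum λ b → row (e₂ b))
        ≡⟨ cong₂ _+_
             (sum-cong-≗ λ a → trans (row-split (e₁ a))
               (trans (cong (to₁ (e₁ a) +_) (to₂∘e₁≡0 a)) (ℕP.+-identityʳ _)))
             (sum-cong-≗ λ b → trans (row-split (e₂ b)) (cong (_+ to₂ (e₂ b)) (to₁∘e₂≡0 b))) ⟩
      degreeSumOn X e₁ + degreeSumOn X e₂ ∎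
      where open ≡-Reasoning

  P-≅ : ∀ {A B} → A ≅ B → P B → P A
  P-≅ A≅B = P-≼ (inj₁ A≅B ◅ ε)

  P-≅-Op : ∀ {A B C} → A ≅ B → Op B C → P C → P A
  P-≅-Op A≅B op = P-≼ (inj₁ A≅B ◅ inj₂ op ◅ ε)

  Side-pullback : ∀ {X Z : Graph} {c : Vertex Z → Bool} {s}
    (h : Vertex X → Vertex Z) → IsInjective h →
    (g : ∀ i → c i ≡ s → Vertex X) → (∀ i p → h (g i p) ≡ i) →
    (∀ x y → c (h x) ≡ s → c (h y) ≡ s → E X x y ≡ E Z (h x) (h y)) →
    Side Z c s → Side X (c ∘ h) s
  Side-pullback {X} {Z} {c} {s} h h-inj g h∘g E-h (side M e e-inj e-col e⁻¹ e∘e⁻¹ P-e) =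
    side M e′ e′-inj e′-col (λ i → e⁻¹ (h i)) e′∘e⁻¹ (P-on-pullback M e e-col P-e)
    where
    e′ : Fin M → Vertex X
    e′ a = g (e a) (e-col a)
    e′-inj : IsInjective e′
    e′-inj a b eq = e-inj a b (trans (sym (h∘g _ _)) (trans (cong h eq) (h∘g _ _)))
    e′-col : ∀ a → c (h (e′ a)) ≡ s
    e′-col a = trans (cong c (h∘g _ _)) (e-col a)
    e′∘e⁻¹ : ∀ i p → e′ (e⁻¹ (h i) p) ≡ i
    e′∘e⁻¹ i p = h-inj _ _ (trans (h∘g _ _) (e∘e⁻¹ (h i) p))
    P-on-pullback : ∀ M (e : Fin M → Vertex Z) (e-col : ∀ a → c (e a) ≡ s) →
                    P-on Z M e → P-on X M (λ a → g (e a) (e-col a))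
    P-on-pullback zero e e-col _ = tt
    P-on-pullback (suc m) e e-col = P-≅ (same-adj⇒≅ λ a b →
      trans (E-h _ _ (trans (cong c (h∘g _ _)) (e-col a)) (trans (cong c (h∘g _ _)) (e-col b)))
            (cong₂ (E Z) (h∘g _ _) (h∘g _ _)))

  -- The colour class of the vertex v = e w, with v removed.
  Side-without : ∀ {k m s} (ax : Fin (suc k) → Fin (suc k) → Bool) (c : Fin (suc (suc k)) → Bool)
    (v : Fin (suc (suc k))) (e : Fin (suc (suc m)) → Fin (suc (suc k))) → IsInjective e →
    (∀ a → c (e a) ≡ s) → (e⁻¹ : ∀ i → c i ≡ s → Fin (suc (suc m))) → (∀ i p → e (e⁻¹ i p) ≡ i) →
    (w : Fin (suc (suc m))) → e w ≡ v →
    ((e′ : Fin (suc m) → Fin (suc k)) → IsInjective e′ →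
      (∀ a → punchIn v (e′ a) ≡ e (punchIn w a)) → P (induced (graph k ax) e′)) →
    Side (graph k ax) (c ∘ punchIn v) s
  Side-without {k} {m} {s} ax c v e e-inj e-col e⁻¹ e∘e⁻¹ w ew≡v P-e′ =
    side (suc m) e′ e′-inj e′-col e′⁻¹ e′∘e′⁻¹ (P-e′ e′ e′-inj punchIn∘e′)
    where
    v≢e∘punchIn : ∀ a → v ≢ e (punchIn w a)
    v≢e∘punchIn a eq = FinP.punchInᵢ≢i w a (e-inj _ _ (trans (sym eq) (sym ew≡v)))
    e′ : Fin (suc m) → Fin (suc k)
    e′ a = punchOut (v≢e∘punchIn a)
    punchIn∘e′ : ∀ a → punchIn v (e′ a) ≡ e (punchIn w a)
    punchIn∘e′ a = FinP.punchIn-punchOut (v≢e∘punchIn a)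
    e′-inj : IsInjective e′
    e′-inj a b eq = FinP.punchIn-injective w a b
      (e-inj _ _ (FinP.punchOut-injective (v≢e∘punchIn a) (v≢e∘punchIn b) eq))
    e′-col : ∀ a → c (punchIn v (e′ a)) ≡ s
    e′-col a = trans (cong c (punchIn∘e′ a)) (e-col _)
    w≢e⁻¹ : ∀ i p → w ≢ e⁻¹ (punchIn v i) p
    w≢e⁻¹ i p eq = FinP.punchInᵢ≢i v i (trans (sym (e∘e⁻¹ _ p)) (trans (cong e (sym eq)) ew≡v))
    e′⁻¹ : ∀ i → c (punchIn v i) ≡ s → Fin (suc m)
    e′⁻¹ i p = punchOut (w≢e⁻¹ i p)
    e′∘e′⁻¹ : ∀ i p → e′ (e′⁻¹ i p) ≡ i
    e′∘e′⁻¹ i p = FinP.punchIn-injective v _ _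
      (trans (punchIn∘e′ _) (trans (cong e (FinP.punchIn-punchOut (w≢e⁻¹ i p))) (e∘e⁻¹ _ p)))

  Side-without-only : ∀ {k s} (ax : Fin (suc k) → Fin (suc k) → Bool) (c : Fin (suc (suc k)) → Bool)
    (v : Fin (suc (suc k))) (e : Fin 1 → Fin (suc (suc k))) →
    (e⁻¹ : ∀ i → c i ≡ s → Fin 1) → (∀ i p → e (e⁻¹ i p) ≡ i) → e Fin.zero ≡ v →
    Side (graph k ax) (c ∘ punchIn v) s
  Side-without-only ax c v e e⁻¹ e∘e⁻¹ e0≡v =
    side zero (λ ()) (λ ()) (λ ()) (λ i p → ⊥-elim (absurd i p)) (λ i p → ⊥-elim (absurd i p)) tt
    where
    absurd : ∀ i p → ⊥
    absurd i p with Fin.zero ← e⁻¹ (punchIn v i) p in eq =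
      FinP.punchInᵢ≢i v i (trans (sym (e∘e⁻¹ _ p)) (trans (cong e eq) e0≡v))

  Split-≅ : ∀ {X Z} → X ≅ Z → Split Z → Split X
  Split-≅ {X} {Z} (σ , E-σ) (split c c-resp side₁ side₂) =
    split (c ∘ to) (λ i j h → c-resp _ _ (trans (E-σ i j) h)) (pull side₁) (pull side₂)
    where
    open Inverse σ using (to; from; strictlyInverseˡ; strictlyInverseʳ)
    to-inj : IsInjective to
    to-inj x y eq = trans (sym (strictlyInverseʳ x)) (trans (cong from eq) (strictlyInverseʳ y))
    pull : ∀ {s} → Side Z c s → Side X (c ∘ to) s
    pull = Side-pullback to to-inj (λ i _ → from i) (λ i _ → strictlyInverseˡ i) (λ x y _ _ → sym (E-σ x y))

  Split-deleteEdge : ∀ Z u v → E Z u v ≡ true → Split Z → Split (deleteEdge Z u v)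
  Split-deleteEdge Z u v uv∈E (split c c-resp side₁ side₂) = split c c-resp′ (keep side₁) (keep side₂)
    where
    X = deleteEdge Z u v
    c-resp′ : ∀ i j → E X i j ≡ true → c i ≡ c j
    c-resp′ i j h = c-resp i j (proj₁ (∧-true (trans (sym (E-deleteEdge Z u v i j)) h)))
    cu≡cv = c-resp u v uv∈E
    P-on-deleteEdge : ∀ {s} M (e : Fin M → Vertex Z) → IsInjective e → (∀ a → c (e a) ≡ s) →
      (e⁻¹ : ∀ i → c i ≡ s → Fin M) → (∀ i p → e (e⁻¹ i p) ≡ i) → P-on Z M e → P-on X M e
    P-on-deleteEdge zero _ _ _ _ _ _ = tt
    P-on-deleteEdge {s} (suc m) e e-inj e-col e⁻¹ e∘e⁻¹ with c u 𝔹.≟ s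
    -- the deleted edge lies in this class: delete it from the induced graph as well
    ... | yes cu≡s = P-≅-Op (same-E⇒≅ {a = adj (induced X e)} {b = adj (deleteEdge R au av)} same)
                            (delE R au av au-av∈E)
      where
      R = induced Z e
      au = e⁻¹ u cu≡s
      av = e⁻¹ v (trans (sym cu≡cv) cu≡s)
      ==au : ∀ a → (a == au) ≡ (e a == u)
      ==au a = trans (sym (injective⇒==-preserved e e-inj a au)) (cong (e a ==_) (e∘e⁻¹ u cu≡s))
      ==av : ∀ a → (a == av) ≡ (e a == v)
      ==av a = trans (sym (injective⇒==-preserved e e-inj a av)) (cong (e a ==_) (e∘e⁻¹ v _))
      same : ∀ a b → E (deleteEdge R au av) a b ≡ E (induced X e) a b
      same a b = begin
        E (deleteEdge R au av) a b                ≡⟨ E-deleteEdge R au av a b ⟩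
        E R a b ∧ not (sameEdge au av a b)        ≡⟨ cong₂ _∧_ (E-induced Z e e-inj a b)
             (cong not (cong₂ _∨_ (cong₂ _∧_ (==au a) (==av b)) (cong₂ _∧_ (==av a) (==au b)))) ⟩
        E Z (e a) (e b) ∧ not (sameEdge u v (e a) (e b)) ≡⟨ sym (E-deleteEdge Z u v (e a) (e b)) ⟩
        E X (e a) (e b)                           ≡⟨ sym (E-induced X e e-inj a b) ⟩
        E (induced X e) a b                       ∎
        where open ≡-Reasoning
      au-av∈E : E R au av ≡ true
      au-av∈E = trans (E-induced Z e e-inj au av) (trans (cong₂ (E Z) (e∘e⁻¹ u _) (e∘e⁻¹ v _)) uv∈E)
    ... | no cu≢s = P-≅ (same-E⇒≅ {a = adj (induced X e)} {b = adj (induced Z e)} same)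
      where
      same : ∀ a b → E (induced Z e) a b ≡ E (induced X e) a b
      same a b = begin
        E (induced Z e) a b                                ≡⟨ E-induced Z e e-inj a b ⟩
        E Z (e a) (e b)                                    ≡⟨ sym (𝔹.∧-identityʳ _) ⟩
        E Z (e a) (e b) ∧ true                             ≡⟨ cong (λ t → E Z (e a) (e b) ∧ not t) (sym not-uv) ⟩
        E Z (e a) (e b) ∧ not (sameEdge u v (e a) (e b))   ≡⟨ sym (E-deleteEdge Z u v (e a) (e b)) ⟩
        E X (e a) (e b)                                    ≡⟨ sym (E-induced X e e-inj a b) ⟩
        E (induced X e) a b                                ∎
        where
        open ≡-Reasoning
        ea≢u : (e a == u) ≡ false
        ea≢u = ≢⇒==-false λ eq → cu≢s (trans (cong c (sym eq)) (e-col a))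
        ea≢v : (e a == v) ≡ false
        ea≢v = ≢⇒==-false λ eq → cu≢s (trans cu≡cv (trans (cong c (sym eq)) (e-col a)))
        not-uv : sameEdge u v (e a) (e b) ≡ false
        not-uv rewrite ea≢u | ea≢v = refl
    keep : ∀ {s} → Side Z c s → Side X c s
    keep (side M e e-inj e-col e⁻¹ e∘e⁻¹ P-e) =
      side M e e-inj e-col e⁻¹ e∘e⁻¹ (P-on-deleteEdge M e e-inj e-col e⁻¹ e∘e⁻¹ P-e)

  Split-deleteVertex : ∀ {k} (a : Fin (suc (suc k)) → Fin (suc (suc k)) → Bool) v →
                       Split (graph (suc k) a) → Split (deleteVertex a v)
  Split-deleteVertex {k} a v (split c c-resp side₁ side₂) =
    split (c ∘ punchIn v) c-resp′ (shrink side₁) (shrink side₂)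
    where
    Z = graph (suc k) a
    X = deleteVertex a v
    punchIn-inj = FinP.punchIn-injective v
    c-resp′ : ∀ i j → E X i j ≡ true → c (punchIn v i) ≡ c (punchIn v j)
    c-resp′ i j h = c-resp _ _ (trans (sym (E-induced Z (punchIn v) punchIn-inj i j)) h)
    shrink-own : ∀ {s} → Side Z c s → c v ≡ s → Side X (c ∘ punchIn v) s
    shrink-own (side zero e _ _ e⁻¹ _ _) cv≡s with () ← e⁻¹ v cv≡s
    shrink-own (side (suc zero) e _ _ e⁻¹ e∘e⁻¹ _) cv≡s with Fin.zero ← e⁻¹ v cv≡s in eq =
      Side-without-only (adj X) c v e e⁻¹ e∘e⁻¹ (trans (cong e (sym eq)) (e∘e⁻¹ v cv≡s))
    shrink-own (side (suc (suc m)) e e-inj e-col e⁻¹ e∘e⁻¹ P-e) cv≡s =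
      Side-without (adj X) c v e e-inj e-col e⁻¹ e∘e⁻¹ w (e∘e⁻¹ v cv≡s) P-e′
      where
      w = e⁻¹ v cv≡s
      R = induced Z e
      P-e′ : (e′ : Fin (suc m) → Fin (suc k)) → IsInjective e′ →
             (∀ a → punchIn v (e′ a) ≡ e (punchIn w a)) → P (induced X e′)
      P-e′ e′ e′-inj punchIn∘e′ = P-≅-Op (same-adj⇒≅ same) (delV (adj R) w) P-e
        where
        same : ∀ i j → E X (e′ i) (e′ j) ≡ E R (punchIn w i) (punchIn w j)
        same i j = trans (E-induced Z (punchIn v) punchIn-inj (e′ i) (e′ j))
          (trans (cong₂ (E Z) (punchIn∘e′ i) (punchIn∘e′ j))
                 (sym (E-induced Z e e-inj (punchIn w i) (punchIn w j))))
    shrink : ∀ {s} → Side Z c s → Side X (c ∘ punchIn v) s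
    shrink {s} S with c v 𝔹.≟ s
    ... | yes cv≡s = shrink-own S cv≡s
    ... | no cv≢s = Side-pullback (punchIn v) punchIn-inj
      (λ i p → punchOut {i = v} {j = i} λ eq → cv≢s (trans (cong c eq) p))
      (λ _ _ → FinP.punchIn-punchOut _) (λ x y _ _ → E-induced Z (punchIn v) punchIn-inj x y) S

  Split-contract : ∀ {k} (a : Fin (suc (suc k)) → Fin (suc (suc k)) → Bool) u v →
                   E (graph (suc k) a) u v ≡ true →
                   Split (graph (suc k) a) → Split (contract a u v)
  Split-contract {k} a u v uv∈E (split c c-resp side₁ side₂) =
    split (c ∘ punchIn v) c-resp′ (shrink side₁) (shrink side₂)
    where
    Z = graph (suc k) a
    X = contract a u v
    punchIn-inj = FinP.punchIn-injective v
    cu≡cv = c-resp u v uv∈E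
    c-resp′ : ∀ i j → E X i j ≡ true → c (punchIn v i) ≡ c (punchIn v j)
    c-resp′ i j h with ∨-true (proj₂ (∧-true {not (i == j)} (trans (sym (E-contract a u v i j)) h)))
    ... | inj₁ ij∈E = c-resp _ _ ij∈E
    ... | inj₂ h′ with ∨-true {punchIn v i == u ∧ E Z v (punchIn v j)} h′
    ... | inj₁ h″ = let (i≡u , vj∈E) = ∧-true {punchIn v i == u} h″ in
      trans (cong c (==-true⇒≡ i≡u)) (trans cu≡cv (c-resp _ _ vj∈E))
    ... | inj₂ h″ = let (j≡u , iv∈E) = ∧-true {punchIn v j == u} h″ in
      trans (c-resp _ _ iv∈E) (sym (trans (cong c (==-true⇒≡ j≡u)) cu≡cv))
    shrink-own : ∀ {s} → Side Z c s → c u ≡ s → Side X (c ∘ punchIn v) s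
    shrink-own (side zero e _ _ e⁻¹ _ _) cu≡s with () ← e⁻¹ u cu≡s
    shrink-own (side (suc zero) e _ _ e⁻¹ e∘e⁻¹ _) cu≡s
      with Fin.zero ← e⁻¹ u cu≡s in eq-u | Fin.zero ← e⁻¹ v (trans (sym cu≡cv) cu≡s) in eq-v
      = ⊥-elim (E⇒≢ Z uv∈E (trans (sym (e∘e⁻¹ u cu≡s)) (trans (cong e (trans eq-u (sym eq-v))) (e∘e⁻¹ v _))))
    shrink-own (side (suc (suc m)) e e-inj e-col e⁻¹ e∘e⁻¹ P-e) cu≡s =
      Side-without (adj X) c v e e-inj e-col e⁻¹ e∘e⁻¹ av (e∘e⁻¹ v cv≡s) P-e′
      where
      cv≡s = trans (sym cu≡cv) cu≡s
      au = e⁻¹ u cu≡s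
      av = e⁻¹ v cv≡s
      R = induced Z e
      E-R : ∀ x y → E R x y ≡ E Z (e x) (e y)
      E-R = E-induced Z e e-inj
      au-av∈E : E R au av ≡ true
      au-av∈E = trans (E-R au av) (trans (cong₂ (E Z) (e∘e⁻¹ u cu≡s) (e∘e⁻¹ v cv≡s)) uv∈E)
      ==au : ∀ x → (x == au) ≡ (e x == u)
      ==au x = trans (sym (injective⇒==-preserved e e-inj x au)) (cong (e x ==_) (e∘e⁻¹ u cu≡s))
      P-e′ : (e′ : Fin (suc m) → Fin (suc k)) → IsInjective e′ →
             (∀ a → punchIn v (e′ a) ≡ e (punchIn av a)) → P (induced X e′)
      P-e′ e′ e′-inj punchIn∘e′ =
        P-≅-Op (same-E⇒≅ {a = adj (induced X e′)} {b = adj (contract (adj R) au av)} same)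
               (contr (adj R) au av au-av∈E) P-e
        where
        same-contractAdj : ∀ i j → contractAdj (adj R) au av i j ≡ contractAdj a u v (e′ i) (e′ j)
        same-contractAdj i j = cong₂ _∨_
          (trans (E-R _ _) (sym (cong₂ (E Z) (punchIn∘e′ i) (punchIn∘e′ j))))
          (cong₂ _∨_
            (cong₂ _∧_ (trans (==au _) (cong (_== u) (sym (punchIn∘e′ i))))
                       (trans (E-R _ _) (cong₂ (E Z) (e∘e⁻¹ v cv≡s) (sym (punchIn∘e′ j)))))
            (cong₂ _∧_ (trans (==au _) (cong (_== u) (sym (punchIn∘e′ j))))
                       (trans (E-R _ _) (cong₂ (E Z) (sym (punchIn∘e′ i)) (e∘e⁻¹ v cv≡s)))))
        same : ∀ i j → E (contract (adj R) au av) i j ≡ E (induced X e′) i j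
        same i j = begin
          E (contract (adj R) au av) i j                     ≡⟨ E-contract (adj R) au av i j ⟩
          not (i == j) ∧ contractAdj (adj R) au av i j
            ≡⟨ cong₂ _∧_ (cong not (sym (injective⇒==-preserved e′ e′-inj i j))) (same-contractAdj i j) ⟩
          not (e′ i == e′ j) ∧ contractAdj a u v (e′ i) (e′ j) ≡⟨ sym (E-contract a u v (e′ i) (e′ j)) ⟩
          E X (e′ i) (e′ j)                                  ≡⟨ sym (E-induced X e′ e′-inj i j) ⟩
          E (induced X e′) i j                               ∎
          where open ≡-Reasoning
    shrink : ∀ {s} → Side Z c s → Side X (c ∘ punchIn v) s
    shrink {s} S with c u 𝔹.≟ s
    ... | yes cu≡s = shrink-own S cu≡s
    ... | no cu≢s = Side-pullback (punchIn v) punchIn-inj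
      (λ i p → punchOut {i = v} {j = i} λ eq → cu≢s (trans cu≡cv (trans (cong c eq) p)))
      (λ _ _ → FinP.punchIn-punchOut _) E-away-from-u S
      where
      E-away-from-u : ∀ x y → c (punchIn v x) ≡ s → c (punchIn v y) ≡ s →
                      E X x y ≡ E Z (punchIn v x) (punchIn v y)
      E-away-from-u x y cx≡s cy≡s = begin
        E X x y                                          ≡⟨ E-contract a u v x y ⟩
        not (x == y) ∧ contractAdj a u v x y
          ≡⟨ cong (not (x == y) ∧_) (trans (cong₂ (λ t t′ → x′y′ ∨ (t ∧ E Z v y′) ∨ (t′ ∧ E Z x′ v)) (≢u cx≡s) (≢u cy≡s))
                                          (𝔹.∨-identityʳ x′y′)) ⟩
        not (x == y) ∧ x′y′
          ≡⟨ not∧-absorb (x == y) x′y′ (λ h → ≢⇒==-false λ x≡y → E⇒≢ Z h (cong (punchIn v) x≡y)) ⟩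
        x′y′                                             ∎
        where
        open ≡-Reasoning
        x′ = punchIn v x
        y′ = punchIn v y
        x′y′ = E Z x′ y′
        ≢u : ∀ {z} → c z ≡ s → (z == u) ≡ false
        ≢u cz≡s = ≢⇒==-false λ z≡u → cu≢s (trans (cong c (sym z≡u)) cz≡s)

  Split-≼ : ∀ {X Z} → X ≼ Z → Split Z → Split X
  Split-≼ ε = id
  Split-≼ (inj₁ X≅Y ◅ Y≼Z) = Split-≅ X≅Y ∘ Split-≼ Y≼Z
  Split-≼ (inj₂ (delE Y u v uv∈E) ◅ Y≼Z) = Split-deleteEdge Y u v uv∈E ∘ Split-≼ Y≼Z
  Split-≼ (inj₂ (delV a v) ◅ Y≼Z) = Split-deleteVertex a v ∘ Split-≼ Y≼Z
  Split-≼ (inj₂ (contr a u v uv∈E) ◅ Y≼Z) = Split-contract a u v uv∈E ∘ Split-≼ Y≼Z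

  Split-⊔ : ∀ {A B} → P A → P B → Split (A ⊔ B)
  Split-⊔ {A} {B} PA PB = split c c-resp left right
    where
    nA = suc (k A)
    nB = suc (k B)
    isLeft : Vertex A ⊎ Vertex B → Bool
    isLeft = [ (λ _ → true) , (λ _ → false) ]′
    c : Vertex (A ⊔ B) → Bool
    c x = isLeft (splitAt nA x)
    same-part : ∀ p q b → not b ∧ (⊔-adj A B p q ∨ ⊔-adj A B q p) ≡ true → isLeft p ≡ isLeft q
    same-part (inj₁ _) (inj₁ _) _ _ = refl
    same-part (inj₂ _) (inj₂ _) _ _ = refl
    same-part (inj₁ _) (inj₂ _) b h with () ← trans (sym (𝔹.∧-zeroʳ (not b))) h
    same-part (inj₂ _) (inj₁ _) b h with () ← trans (sym (𝔹.∧-zeroʳ (not b))) h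
    c-resp : ∀ x y → E (A ⊔ B) x y ≡ true → c x ≡ c y
    c-resp x y = same-part (splitAt nA x) (splitAt nA y) (x == y)
    fromLeft : ∀ x → c x ≡ true → Vertex A
    fromLeft x p with splitAt nA x
    ... | inj₁ i = i
    fromLeft∘↑ˡ : ∀ x p → fromLeft x p ↑ˡ nB ≡ x
    fromLeft∘↑ˡ x p with splitAt nA x in eq
    ... | inj₁ i = FinP.splitAt⁻¹-↑ˡ eq
    fromRight : ∀ x → c x ≡ false → Vertex B
    fromRight x p with splitAt nA x
    ... | inj₂ j = j
    ↑ʳ∘fromRight : ∀ x p → nA ↑ʳ fromRight x p ≡ x
    ↑ʳ∘fromRight x p with splitAt nA x in eq
    ... | inj₂ j = FinP.splitAt⁻¹-↑ʳ eq
    left : Side (A ⊔ B) c true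
    left = side nA (_↑ˡ nB) (FinP.↑ˡ-injective nB) (λ i → cong isLeft (FinP.splitAt-↑ˡ nA i nB))
      fromLeft fromLeft∘↑ˡ
      (P-≅ (same-E⇒≅ {a = adj (induced (A ⊔ B) (_↑ˡ nB))} {b = adj A} λ i j →
        sym (trans (E-induced (A ⊔ B) (_↑ˡ nB) (FinP.↑ˡ-injective nB) i j) (E-⊔ˡ A B i j))) PA)
    right : Side (A ⊔ B) c false
    right = side nB (nA ↑ʳ_) (FinP.↑ʳ-injective nA) (λ j → cong isLeft (FinP.splitAt-↑ʳ nA nB j))
      fromRight ↑ʳ∘fromRight
      (P-≅ (same-E⇒≅ {a = adj (induced (A ⊔ B) (nA ↑ʳ_))} {b = adj B} λ i j →
        sym (trans (E-induced (A ⊔ B) (nA ↑ʳ_) (FinP.↑ʳ-injective nA) i j) (E-⊔ʳ A B i j))) PB)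

degreeSum-⊔ : ∀ A B → degreeSum (A ⊔ B) ≡ degreeSum A + degreeSum B
degreeSum-⊔ A B = trans (degreeSum-Split (Split-⊔ {A} {B} tt tt)) (cong₂ _+_
  (sum-cong-≗ λ i → sum-cong-≗ λ j → cong 𝟙 (E-⊔ˡ A B i j))
  (sum-cong-≗ λ i → sum-cong-≗ λ j → cong 𝟙 (E-⊔ʳ A B i j)))
  where open Partitions (λ _ → ⊤) (λ _ _ → tt)

-- copies G t consists of t + 1 disjoint copies of G.
copies : Graph → ℕ → Graph
copies G zero = G
copies G (suc t) = G ⊔ copies G t

∣V∣-copies : ∀ G t → ∣V∣ (copies G t) ≡ suc t * ∣V∣ G
∣V∣-copies G zero = sym (ℕP.+-identityʳ (∣V∣ G))
∣V∣-copies G (suc t) = cong (∣V∣ G +_) (∣V∣-copies G t)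

degreeSum-copies : ∀ G t → degreeSum (copies G t) ≡ suc t * degreeSum G
degreeSum-copies G zero = sym (ℕP.+-identityʳ (degreeSum G))
degreeSum-copies G (suc t) =
  trans (degreeSum-⊔ G (copies G t)) (cong (degreeSum G +_) (degreeSum-copies G t))

density≤density-copies : ∀ G t → density G ℚ.≤ density (copies G t)
density≤density-copies G t = Equivalence.from (density-≤⇔ G (copies G t)) (ℕP.≤-reflexive (begin
  ∣V∣ (copies G t) * degreeSum G   ≡⟨ cong (_* degreeSum G) (∣V∣-copies G t) ⟩
  suc t * ∣V∣ G * degreeSum G      ≡⟨ solve 3 (λ t n d → t :* n :* d := t :* d :* n) refl (suc t) (∣V∣ G) (degreeSum G) ⟩
  suc t * degreeSum G * ∣V∣ G      ≡⟨ cong (_* ∣V∣ G) (degreeSum-copies G t) ⟨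
  degreeSum (copies G t) * ∣V∣ G   ∎))
  where open ≡-Reasoning

<∣V∣-copies : ∀ G t → t ℕ.< ∣V∣ (copies G t)
<∣V∣-copies G t = ℕP.<-≤-trans (ℕP.n<1+n t)
  (subst (suc t ℕ.≤_) (sym (∣V∣-copies G t)) (ℕP.m≤m*n (suc t) (∣V∣ G)))

MinorsNoDenserThan : Graph → Family
MinorsNoDenserThan G H = ∀ H′ → H′ ≼ H → density H′ ℚ.≤ density G

module NoDenserThan (G : Graph) where

  F : Family
  F = MinorsNoDenserThan G

  F-≼ : ∀ {A B} → A ≼ B → F B → F A
  F-≼ A≼B FB H H≼A = FB H (H≼A ◅◅ A≼B)

  F-minorClosed : MinorClosed F
  F-minorClosed A B FA B≼A = F-≼ B≼A FA

  open Partitions F F-≼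

  degreeSumOn-Side≤ : ∀ {X c s} (S : Side X c s) →
    ∣V∣ G * degreeSumOn X (Side.e S) ℕ.≤ degreeSum G * Side.M S
  degreeSumOn-Side≤ (side zero _ _ _ _ _ _) =
    ℕP.≤-reflexive (trans (ℕP.*-zeroʳ (∣V∣ G)) (sym (ℕP.*-zeroʳ (degreeSum G))))
  degreeSumOn-Side≤ {X} (side (suc m) e e-inj _ _ _ P-e) =
    subst (λ d → ∣V∣ G * d ℕ.≤ degreeSum G * suc m) degreeSum-induced
      (Equivalence.to (density-≤⇔ (induced X e) G) (P-e (induced X e) ε))
    where
    degreeSum-induced : degreeSum (induced X e) ≡ degreeSumOn X e
    degreeSum-induced = sum-cong-≗ λ a → sum-cong-≗ λ b → cong 𝟙 (E-induced X e e-inj a b)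

  Split⇒density≤ : ∀ {X} → Split X → density X ℚ.≤ density G
  Split⇒density≤ {X} sp = Equivalence.from (density-≤⇔ X G) (begin
    ∣V∣ G * degreeSum X                                   ≡⟨ cong (∣V∣ G *_) (degreeSum-Split sp) ⟩
    ∣V∣ G * (degreeSumOn X (Side.e S₁) + degreeSumOn X (Side.e S₂))
      ≡⟨ ℕP.*-distribˡ-+ (∣V∣ G) (degreeSumOn X (Side.e S₁)) (degreeSumOn X (Side.e S₂)) ⟩
    ∣V∣ G * degreeSumOn X (Side.e S₁) + ∣V∣ G * degreeSumOn X (Side.e S₂)
      ≤⟨ ℕP.+-mono-≤ (degreeSumOn-Side≤ S₁) (degreeSumOn-Side≤ S₂) ⟩
    degreeSum G * Side.M S₁ + degreeSum G * Side.M S₂     ≡⟨ ℕP.*-distribˡ-+ (degreeSum G) (Side.M S₁) (Side.M S₂) ⟨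
    degreeSum G * (Side.M S₁ + Side.M S₂)                 ≡⟨ cong (degreeSum G *_) (∣V∣-Split sp) ⟨
    degreeSum G * ∣V∣ X                                   ∎)
    where
    open ℕP.≤-Reasoning
    open Split sp renaming (side₁ to S₁; side₂ to S₂)

  F-⊔ : ∀ {A B} → F A → F B → F (A ⊔ B)
  F-⊔ FA FB H H≼A⊔B = Split⇒density≤ (Split-≼ H≼A⊔B (Split-⊔ FA FB))

  DensityMinimal⇒F : DensityMinimal G → F G
  DensityMinimal⇒F minimal H H≼G with ≼⇒≺⊎sameCounts H≼G
  ... | inj₁ H≺G = ℚP.<⇒≤ (minimal H H≺G)
  ... | inj₂ (sameDegreeSum , sameOrder) = Equivalence.from (density-≤⇔ H G)
    (subst₂ (λ d n → ∣V∣ G * d ℕ.≤ degreeSum G * n) (sym sameDegreeSum) (sym sameOrder)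
      (ℕP.≤-reflexive (ℕP.*-comm (∣V∣ G) (degreeSum G))))

  F-copies : F G → ∀ t → F (copies G t)
  F-copies FG zero = FG
  F-copies FG (suc t) = F-⊔ FG (F-copies FG t)

q<q+δ : ∀ q {δ} → 0ℚ ℚ.< δ → q ℚ.< q ℚ.+ δ
q<q+δ q 0<δ = subst (ℚ._< q ℚ.+ _) (ℚP.+-identityʳ q) (ℚP.+-monoʳ-< q 0<δ)

q-δ<q : ∀ q {δ} → 0ℚ ℚ.< δ → q ℚ.- δ ℚ.< q
q-δ<q q 0<δ = subst (q ℚ.- _ ℚ.<_) (ℚP.+-identityʳ q) (ℚP.+-monoʳ-< q (ℚP.neg-antimono-< 0<δ))

corollary1 : ∀ (G : Graph) → DensityMinimal G →
    ∃[ F ] (MinorClosed F × LimitingDensity F (density G))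
corollary1 G minimal = F , F-minorClosed , eventually-below , infinitely-often-above
  where
  open NoDenserThan G
  eventually-below : ∀ δ → 0ℚ ℚ.< δ →
    ∃[ N ] ∀ H → F H → N ℕ.≤ ∣V∣ H → density H ℚ.< density G ℚ.+ δ
  eventually-below δ 0<δ = 0 , λ H FH _ → ℚP.≤-<-trans (FH H ε) (q<q+δ (density G) 0<δ)
  infinitely-often-above : ∀ δ → 0ℚ ℚ.< δ → ∀ N →
    ∃[ n ] (N ℕ.≤ n × ExAbove F n (density G ℚ.- δ))
  infinitely-often-above δ 0<δ N = ∣V∣ (copies G N) , ℕP.<⇒≤ (<∣V∣-copies G N) ,
    inj₁ (copies G N , F-copies (DensityMinimal⇒F minimal) N , refl ,
          ℚP.<-≤-trans (q-δ<q (density G) 0<δ) (density≤density-copies G N))
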